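{- For every $i\ge 3$, the logic $\mathrm{HO}^{i,P}$ collapses to $\mathrm{SO}$: for every $\mathrm{HO}^{i,P}$ formula there is an $\mathrm{SO}$ formula equivalent to it on all finite structures.
   Context: All structures are finite relational structures. Relation types: a third order type of width $w$ is a tuple $(r_1,\ldots,r_w)$ of positive integers; for $i\ge 4$ an $i$-th order type of width $w$ is a tuple $(\rho_1,\ldots,\rho_w)$ of $(i-1)$-th order types. A second order relation is an ordinary relation on the domain; a third order relation of type $(r_1,\ldots,r_w)$ is a set of $w$-tuples of relations of arities $r_1,\ldots,r_w$; for $i\ge4$ an $i$-th order relation of type $(\rho_1,\ldots,\rho_w)$ is a set of $w$-tuples of $(i-1)$-th order relations of types $\rho_1,\ldots,\rho_w$. $\mathrm{HO}^i$ extends first order logic with quantifiers of every order $2\le j\le i$ over $j$-th order relation variables, with atomic formulae $\mathcal{X}(\mathcal{Y}_1,\ldots,\mathcal{Y}_w)$ expressing membership of a tuple of $(j-1)$-th order relations in a $j$-th order relation. A third order relation $\mathcal{R}$ over $\mathbf{A}$ is downward polynomially bounded by $d\ge1$ if $|\mathcal{R}|\le|\mathit{dom}(\mathbf{A})|^d$; for $i\ge4$ an $i$-th order relation is downward polynomially bounded by $d$ if it has at most $|\mathit{dom}(\mathbf{A})|^d$ tuples and, for all $3\le j\le i-1$, all $j$-th order relations occurring (recursively) in its tuples are downward polynomially bounded by $d$. $\mathrm{HO}^{3,P}=\mathrm{TO}^P$ is SO extended with third order variables $\mathcal{X}^{d,\bar r}$ and quantifiers $\exists^{P,d}$ ranging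 only over third order relations of type $\bar r$ with at most $|\mathit{dom}(\mathbf{A})|^d$ tuples. For $i\ge4$, $\mathrm{HO}^{i,P}$ extends $\mathrm{HO}^{i-1,P}$ with, for every $d\ge1$ and $i$-th order type $\tau$, variables $\mathcal{X}^{i,d,\tau}$ and quantifiers $\exists^{i,P,d}$ with semantics: $\mathbf{A}\models\exists^{i,P,d}\mathcal{X}^{i,d,\tau}\varphi(\mathcal{X})$ iff there is an $i$-th order relation $\mathcal{R}$ of type $\tau$ downward polynomially bounded by $d$ in $\mathbf{A}$ with $\mathbf{A}\models\varphi[\mathcal{R}/\mathcal{X}]$. Formulae of $\mathrm{HO}^{i,P}$ have no free relation variables of order $\ge 2$. -}

module Defs where

open import Data.Nat using (ℕ; zero; suc; _≤_; _^_; _+_)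
open import Data.Fin using (Fin)
open import Data.Bool using (Bool; true)
open import Data.Vec using (Vec; lookup)
import Data.Vec as V
open import Data.List using (List; _∷_; []; length)
open import Data.List.Relation.Unary.Any using (Any)
open import Data.List.Relation.Unary.All using (All)
import Data.List.Relation.Unary.All as All
open import Data.List.Membership.Propositional using (_∈_)
open import Data.Product using (Σ; _×_; proj₁; _,_)
open import Data.Sum using (_⊎_)
open import Relation.Nullary using (¬_)
open import Relation.Binary.PropositionalEquality using (_≡_)

-- Ty k is the set of (k+2)-th order types:
--   Ty 0 : an arity; the code r stands for the (positive) arity r+1
--          (a second order relation = ordinary relation on the domain).
--   Ty (suc k) : a tuple (ρ_1,…,ρ_w) of width w+1 ≥ 1 of (k+2)-th order
--          types, i.e. a (k+3)-th order type.

Ty : ℕ → Set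
Ty zero    = ℕ
Ty (suc k) = Σ ℕ (λ w → Vec (Ty k) (suc w))

Vocab : Set
Vocab = List ℕ

record Structure (σ : Vocab) : Set where
  field
    n        : ℕ
    nonempty : 1 ≤ n
    rels     : All (λ r → Vec (Fin n) r → Bool) σ
open Structure public

-- Obj n k τ : (k+2)-th order relations of type τ.
--   order 2 : subsets of Fin n ^ (r+1)
--   order k+3 : sets of tuples of (k+2)-th order relations, given by a
--               characteristic function that respects (extensional)
--               equality of relations.
-- _≈_ is extensional equality of relations; sets of relations are thus
-- sets of ≈-classes.

module _ (n : ℕ) where
  mutual
    Obj : (k : ℕ) → Ty k → Set
    Obj zero    r        = Vec (Fin n) (suc r) → Bool
    Obj (suc k) (w , ρs) = Σ (Tup k ρs → Bool) (Resp k ρs)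

    ObjEq : (k : ℕ) (τ : Ty k) → Obj k τ → Obj k τ → Set
    ObjEq zero    r        R S = ∀ v → R v ≡ S v
    ObjEq (suc k) (w , ρs) R S = ∀ t → proj₁ R t ≡ proj₁ S t

    Tup : (k : ℕ) {w : ℕ} → Vec (Ty k) (suc w) → Set
    Tup k {w} ρs = (j : Fin (suc w)) → Obj k (lookup ρs j)

    TupEq : (k : ℕ) {w : ℕ} (ρs : Vec (Ty k) (suc w)) → Tup k ρs → Tup k ρs → Set
    TupEq k {w} ρs t t' = (j : Fin (suc w)) → ObjEq k (lookup ρs j) (t j) (t' j)

    Resp : (k : ℕ) {w : ℕ} (ρs : Vec (Ty k) (suc w)) → (Tup k ρs → Bool) → Set
    Resp k ρs f = ∀ t t' → TupEq k ρs t t' → f t ≡ f t'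

  AtMost : ℕ → (k : ℕ) (τ : Ty (suc k)) → Obj (suc k) τ → Set
  AtMost N k (w , ρs) R =
    Σ (List (Tup k ρs)) λ L →
      length L ≤ N × (∀ t → proj₁ R t ≡ true → Any (TupEq k ρs t) L)

  DPB : ℕ → (k : ℕ) (τ : Ty (suc k)) → Obj (suc k) τ → Set
  DPB d zero    τ        R = AtMost (n ^ d) zero τ R
  DPB d (suc k) (w , ρs) R =
    AtMost (n ^ d) (suc k) (w , ρs) R ×
    (∀ t → proj₁ R t ≡ true → (j : Fin (suc w)) → DPB d k (lookup ρs j) (t j))

-- Syntax of HO^{i,P}.
-- Sorts of variables: first order; second order of arity r+1;
-- (k+3)-th order of type τ with polynomial bound d (variable X^{k+3,d,τ}).

data Sort : Set where
  fo : Sort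
  so : ℕ → Sort
  ho : (k : ℕ) → Ty (suc k) → ℕ → Sort

Ctx : Set
Ctx = List Sort

-- An argument variable of a (k+3)-th order atom, of (k+2)-th order type ρ
-- (any bound d for orders ≥ 3).
ArgVar : Ctx → (k : ℕ) → Ty k → Set
ArgVar Γ zero    ρ = so ρ ∈ Γ
ArgVar Γ (suc k) ρ = Σ ℕ (λ d → ho k ρ d ∈ Γ)

-- Form σ i Γ : formulae of HO^{i,P} over vocabulary σ with free variables
-- in Γ.  Form σ 2 Γ is exactly (full) second order logic SO.
data Form (σ : Vocab) (i : ℕ) : Ctx → Set where
  eq   : ∀ {Γ} → fo ∈ Γ → fo ∈ Γ → Form σ i Γ
  rel  : ∀ {Γ r} → r ∈ σ → Vec (fo ∈ Γ) r → Form σ i Γ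
  app2 : ∀ {Γ r} → so r ∈ Γ → Vec (fo ∈ Γ) (suc r) → Form σ i Γ
  appH : ∀ {Γ k w d} {ρs : Vec (Ty k) (suc w)} → ho k (w , ρs) d ∈ Γ →
         ((j : Fin (suc w)) → ArgVar Γ k (lookup ρs j)) → Form σ i Γ
  neg  : ∀ {Γ} → Form σ i Γ → Form σ i Γ
  and  : ∀ {Γ} → Form σ i Γ → Form σ i Γ → Form σ i Γ
  or   : ∀ {Γ} → Form σ i Γ → Form σ i Γ → Form σ i Γ
  ex1  : ∀ {Γ} → Form σ i (fo ∷ Γ) → Form σ i Γ
  all1 : ∀ {Γ} → Form σ i (fo ∷ Γ) → Form σ i Γ
  ex2  : ∀ {Γ} (r : ℕ) → 2 ≤ i → Form σ i (so r ∷ Γ) → Form σ i Γ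
  all2 : ∀ {Γ} (r : ℕ) → 2 ≤ i → Form σ i (so r ∷ Γ) → Form σ i Γ
  exH  : ∀ {Γ} (k : ℕ) (τ : Ty (suc k)) (d : ℕ) → 1 ≤ d → 3 + k ≤ i →
         Form σ i (ho k τ d ∷ Γ) → Form σ i Γ
  allH : ∀ {Γ} (k : ℕ) (τ : Ty (suc k)) (d : ℕ) → 1 ≤ d → 3 + k ≤ i →
         Form σ i (ho k τ d ∷ Γ) → Form σ i Γ

SortVal : ℕ → Sort → Set
SortVal n fo         = Fin n
SortVal n (so r)     = Obj n zero r
SortVal n (ho k τ d) = Obj n (suc k) τ

Env : ℕ → Ctx → Set
Env n Γ = All (SortVal n) Γ

argVal : ∀ {n Γ} k {ρ} → Env n Γ → ArgVar Γ k ρ → Obj n k ρ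
argVal zero    e x       = All.lookup e x
argVal (suc k) e (d , x) = All.lookup e x

Sat : ∀ {σ i Γ} (A : Structure σ) → Env (n A) Γ → Form σ i Γ → Set
Sat A e (eq x y)     = All.lookup e x ≡ All.lookup e y
Sat A e (rel p xs)   = All.lookup (rels A) p (V.map (All.lookup e) xs) ≡ true
Sat A e (app2 X xs)  = All.lookup e X (V.map (All.lookup e) xs) ≡ true
Sat A e (appH {k = k} X ys) = proj₁ (All.lookup e X) (λ j → argVal k e (ys j)) ≡ true
Sat A e (neg φ)      = ¬ Sat A e φ
Sat A e (and φ ψ)    = Sat A e φ × Sat A e ψ
Sat A e (or φ ψ)     = Sat A e φ ⊎ Sat A e ψ
Sat A e (ex1 φ)      = Σ (Fin (n A)) λ a → Sat A (a All.∷ e) φ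
Sat A e (all1 φ)     = (a : Fin (n A)) → Sat A (a All.∷ e) φ
Sat A e (ex2 r _ φ)  = Σ (Obj (n A) zero r) λ R → Sat A (R All.∷ e) φ
Sat A e (all2 r _ φ) = (R : Obj (n A) zero r) → Sat A (R All.∷ e) φ
Sat A e (exH k τ d _ _ φ) =
  Σ (Obj (n A) (suc k) τ) λ R → DPB (n A) d k τ R × Sat A (R All.∷ e) φ
Sat A e (allH k τ d _ _ φ) =
  (R : Obj (n A) (suc k) τ) → DPB (n A) d k τ R → Sat A (R All.∷ e) φ

FOCtx : ℕ → Ctx
FOCtx zero    = []
FOCtx (suc m) = fo ∷ FOCtx m

module Submission where

-- The idea (as in the paper) is that a (k+3)-th order relation downward
-- polynomially bounded by d+1 has at most n^(d+1) tuples, so it can be stored in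
-- second order relations: a "selector" relation over (d+1)-tuples of elements says
-- which indices are used, and for each component of the tuple type a code, recursively,
-- with the index as extra parameters, gives the entry stored at that index.

open import Defs
open import Function using (_∘_; id)
open import Function.Bundles using (_⇔_; mk⇔; Equivalence)
open import Function.Construct.Identity using (⇔-id)
open import Function.Construct.Symmetry using (⇔-sym)
open import Function.Construct.Composition using (_⇔-∘_)
open import Data.Nat using (ℕ; zero; suc; _+_; _^_; _≤_; s≤s; z≤n; pred)
open import Data.Nat.Properties using (≤-reflexive)
open import Data.Fin using (Fin; toℕ; inject≤; funToFin; finToFun; combine) renaming (zero to fz; suc to fs)
open import Data.Fin.Properties using (funToFin-finToFin; finToFun-funToFin; toℕ-inject≤)
  renaming (_≟_ to _≟ᶠ_; all? to ∀ᶠ?)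
open import Data.Bool using (Bool; true; false; if_then_else_)
import Data.Bool.Properties as Bool
open import Data.Unit using (⊤; tt)
open import Data.Empty using (⊥; ⊥-elim)
open import Data.Product using (Σ; _×_; _,_; proj₁; proj₂)
open import Data.Product.Function.NonDependent.Propositional using (_×-⇔_)
open import Data.Sum using (_⊎_; inj₁; inj₂)
open import Data.Sum.Function.Propositional using (_⊎-⇔_)
open import Data.Vec using (Vec; []; _∷_; lookup; tabulate)
import Data.Vec as Vec
open import Data.Vec.Properties using (tabulate∘lookup; tabulate-cong; ≡-dec)
open import Data.List using (List; []; _∷_; map; length; allFin; cartesianProductWith)
import Data.List as List
open import Data.List.Properties using (length-map; length-tabulate)
open import Data.List.Relation.Unary.Any using (Any; here; there; satisfied; any?)
import Data.List.Relation.Unary.Any as Any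
open import Data.List.Relation.Unary.Any.Properties using (map⁺; lookup-index; cartesianProductWith⁺)
open import Data.List.Relation.Unary.All using (All; all?; lookupAny)
import Data.List.Relation.Unary.All as All
open import Data.List.Membership.Propositional using (_∈_; lose)
open import Data.List.Membership.Propositional.Properties using (∈-allFin; ∈-map⁺)
open import Relation.Nullary using (¬_; Dec; yes; no; does; _×-dec_)
open import Relation.Nullary.Decidable using (map′; dec-true; does-⇔)
open import Relation.Binary.Structures using (IsEquivalence; IsDecEquivalence)
import Relation.Binary.Construct.On as On
import Relation.Binary.PropositionalEquality as ≡
open import Relation.Binary.PropositionalEquality using (_≡_; refl; sym; trans; cong; cong₂; subst; subst₂)

open Equivalence using (to; from)

⇔-trans : {A B C : Set} → A ⇔ B → B ⇔ C → A ⇔ C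
⇔-trans p q = q ⇔-∘ p

≡⇒⇔ : {A B : Set} → A ≡ B → A ⇔ B
≡⇒⇔ refl = ⇔-id _

→-⇔ : {A B C D : Set} → A ⇔ B → C ⇔ D → (A → C) ⇔ (B → D)
→-⇔ p q = mk⇔ (λ f → to q ∘ f ∘ from p) (λ g → from q ∘ g ∘ to p)

¬-⇔ : {A B : Set} → A ⇔ B → (¬ A) ⇔ (¬ B)
¬-⇔ p = →-⇔ p (⇔-id ⊥)

bool-ext : {a b : Bool} → (a ≡ true ⇔ b ≡ true) → a ≡ b
bool-ext {true}  {true}  _ = refl
bool-ext {false} {false} _ = refl
bool-ext {true}  {false} p with to p refl
... | ()
bool-ext {false} {true}  p with from p refl
... | ()

from-does : {A : Set} (a? : Dec A) → does a? ≡ true → A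
from-does (yes a) _ = a

-- ∃ and ∀ are handled uniformly, both by the translation and in its correctness proof.
data Quant : Set where
  ∃Q ∀Q : Quant

⟦_⟧ : Quant → (X : Set) → (X → Set) → Set
⟦ ∃Q ⟧ X P = Σ X P
⟦ ∀Q ⟧ X P = (x : X) → P x

⟦_⟧ᵇ : Quant → (X : Set) → (X → Set) → (X → Set) → Set
⟦ ∃Q ⟧ᵇ X B P = Σ X λ x → B x × P x
⟦ ∀Q ⟧ᵇ X B P = (x : X) → B x → P x

Q-cong : ∀ q {X : Set} {P P′ : X → Set} → (∀ x → P x ⇔ P′ x) → ⟦ q ⟧ X P ⇔ ⟦ q ⟧ X P′
Q-cong ∃Q h = mk⇔ (λ (x , p) → x , to (h x) p) (λ (x , p) → x , from (h x) p)
Q-cong ∀Q h = mk⇔ (λ f x → to (h x) (f x)) (λ f x → from (h x) (f x))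

Q-pair : ∀ q {X Y : Set} {P : X × Y → Set} →
         ⟦ q ⟧ (X × Y) P ⇔ ⟦ q ⟧ X (λ x → ⟦ q ⟧ Y λ y → P (x , y))
Q-pair ∃Q = mk⇔ (λ ((x , y) , p) → x , y , p) (λ (x , y , p) → (x , y) , p)
Q-pair ∀Q = mk⇔ (λ f x y → f (x , y)) (λ f (x , y) → f x y)

Q-unit : ∀ q {P : ⊤ → Set} → ⟦ q ⟧ ⊤ P ⇔ P tt
Q-unit ∃Q = mk⇔ proj₂ (tt ,_)
Q-unit ∀Q = mk⇔ (λ f → f tt) (λ p _ → p)

Q-nil : ∀ q {X : Set} {P : Vec X 0 → Set} → ⟦ q ⟧ (Vec X 0) P ⇔ P []
Q-nil ∃Q = mk⇔ (λ { ([] , p) → p }) ([] ,_)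
Q-nil ∀Q = mk⇔ (λ f → f []) (λ { p [] → p })

Q-cons : ∀ q {X : Set} {m} {P : Vec X (suc m) → Set} →
         ⟦ q ⟧ (Vec X (suc m)) P ⇔ ⟦ q ⟧ X (λ x → ⟦ q ⟧ (Vec X m) λ xs → P (x ∷ xs))
Q-cons ∃Q = mk⇔ (λ { ((x ∷ xs) , p) → x , xs , p }) (λ (x , xs , p) → (x ∷ xs) , p)
Q-cons ∀Q = mk⇔ (λ f x xs → f (x ∷ xs)) (λ { f (x ∷ xs) → f x xs })

Qᵇ-const : ∀ q {X Z : Set} {B P : X → Set} (x₀ : X) → B x₀ →
           (∀ x → B x → P x ⇔ Z) → ⟦ q ⟧ᵇ X B P ⇔ Z
Qᵇ-const ∃Q x₀ b₀ h = mk⇔ (λ (x , b , p) → to (h x b) p) (λ z → x₀ , b₀ , from (h x₀ b₀) z)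
Qᵇ-const ∀Q x₀ b₀ h = mk⇔ (λ f → to (h x₀ b₀) (f x₀ b₀)) (λ z x b → from (h x b) z)

Q-codes : ∀ q {C X : Set} {_≈_ : X → X → Set} (dec : C → X) {B P : X → Set} →
          (∀ {x y} → x ≈ y → B x → B y) → (∀ c → B (dec c)) →
          (∀ x → B x → Σ C λ c → dec c ≈ x) →
          ⟦ q ⟧ C (λ c → ⟦ q ⟧ᵇ X (dec c ≈_) P) ⇔ ⟦ q ⟧ᵇ X B P
Q-codes ∃Q dec B-resp sound complete =
  mk⇔ (λ (c , x , e , p) → x , B-resp e (sound c) , p)
      (λ (x , b , p) → let (c , e) = complete x b in c , x , e , p)
Q-codes ∀Q dec B-resp sound complete =
  mk⇔ (λ f x b → let (c , e) = complete x b in f c x e)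
      (λ g c x e → g x (B-resp e (sound c)))

-- All semantic objects over a finite domain are finitely enumerable up to
-- extensional equality, which is moreover decidable.  This is what allows a
-- coded relation (a Boolean-valued function) to test membership of a tuple.

record Enumerable {A : Set} (_≈_ : A → A → Set) : Set where
  field
    isDecEquivalence : IsDecEquivalence _≈_
    elements         : List A
    complete         : ∀ x → Any (x ≈_) elements
  open IsDecEquivalence isDecEquivalence public

∃? : {A : Set} {P : A → Set} (xs : List A) → (∀ x → x ∈ xs) →
     (∀ x → Dec (P x)) → Dec (Σ A P)
∃? xs ∈xs P? = map′ satisfied (λ (x , p) → lose (∈xs x) p) (any? P? xs)

≗-isEquivalence : {A B : Set} → IsEquivalence {A = A → B} (λ f g → ∀ x → f x ≡ g x)
≗-isEquivalence = record
  { refl = λ _ → refl ; sym = λ f≗g x → sym (f≗g x) ; trans = λ f≗g g≗h x → trans (f≗g x) (g≗h x) }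

RespectsEq : {A : Set} → (A → A → Set) → (A → Bool) → Set
RespectsEq _≈_ f = ∀ x y → x ≈ y → f x ≡ f y

module PredicateSpace {A : Set} {_≈_ : A → A → Set} (E : Enumerable _≈_) where
  open Enumerable E using (_≟_; elements; complete) renaming (sym to ≈-sym; trans to ≈-trans)

  Pred : Set
  Pred = Σ (A → Bool) (RespectsEq _≈_)

  _≐_ : Pred → Pred → Set
  f ≐ g = ∀ x → proj₁ f x ≡ proj₁ g x

  update : A → Bool → Pred → Pred
  update a b (f , f-resp) = f′ , f′-resp
    where
    f′ : A → Bool
    f′ x = if does (x ≟ a) then b else f x
    f′-resp : RespectsEq _≈_ f′
    f′-resp x y x≈y with x ≟ a | y ≟ a
    ... | yes _   | yes _   = refl
    ... | no _    | no _    = f-resp x y x≈y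
    ... | yes x≈a | no y≉a  = ⊥-elim (y≉a (≈-trans (≈-sym x≈y) x≈a))
    ... | no x≉a  | yes y≈a = ⊥-elim (x≉a (≈-trans x≈y y≈a))

  tables : List A → List Pred
  tables []       = ((λ _ → false) , (λ _ _ _ → refl)) ∷ []
  tables (a ∷ as) = cartesianProductWith (update a) (true ∷ false ∷ []) (tables as)

  AgreeOn : List A → Pred → Pred → Set
  AgreeOn as g f = ∀ x → Any (x ≈_) as → proj₁ f x ≡ proj₁ g x

  tables-complete : ∀ as g → Any (AgreeOn as g) (tables as)
  tables-complete []       g = here (λ x ())
  tables-complete (a ∷ as) g =
    cartesianProductWith⁺ (update a)
      (λ {b} {f} → agree-update {b} {f}) (bool∈ (proj₁ g a)) (tables-complete as g)
    where
    bool∈ : ∀ b → b ∈ true ∷ false ∷ []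
    bool∈ true  = here refl
    bool∈ false = there (here refl)
    agree-update : ∀ {b f} → proj₁ g a ≡ b → AgreeOn as g f → AgreeOn (a ∷ as) g (update a b f)
    agree-update {b} {f} ga≡b f≗g x x∈ with x ≟ a
    ... | yes x≈a = trans (sym ga≡b) (proj₂ g a x (≈-sym x≈a))
    ... | no x≉a with x∈
    ...   | here x≈a   = ⊥-elim (x≉a x≈a)
    ...   | there x∈as = f≗g x x∈as

  _≐?_ : ∀ f g → Dec (f ≐ g)
  (f , f-resp) ≐? (g , g-resp) =
    map′ pointwise (λ f≗g → All.tabulate λ {x} _ → f≗g x) (all? (λ x → f x Bool.≟ g x) elements)
    where
    pointwise : All (λ x → f x ≡ g x) elements → ∀ x → f x ≡ g x
    pointwise eqs x =
      let (fy≡gy , x≈y) = lookupAny eqs (complete x)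
      in trans (f-resp x _ x≈y) (trans fy≡gy (sym (g-resp x _ x≈y)))

  enumerable : Enumerable _≐_
  enumerable = record
    { isDecEquivalence = record { isEquivalence = On.isEquivalence proj₁ ≗-isEquivalence ; _≟_ = _≐?_ }
    ; elements = tables elements
    ; complete = λ g → Any.map (λ g≗f x → sym (g≗f x (complete x))) (tables-complete elements g) }

  -- When ≈ is ≡, every Boolean function is a predicate: relations on A are enumerable.
  functions : (∀ {x y} → x ≈ y → x ≡ y) → Enumerable {A → Bool} (λ f g → ∀ x → f x ≡ g x)
  functions ≈⇒≡ = record
    { isDecEquivalence = record { isEquivalence = ≗-isEquivalence ; _≟_ = λ f g → lift f ≐? lift g }
    ; elements = map proj₁ (tables elements)
    ; complete = λ f → map⁺ (Enumerable.complete enumerable (lift f)) }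
    where
    lift : (A → Bool) → Pred
    lift f = f , λ x y x≈y → cong f (≈⇒≡ x≈y)

_∷ᵈ_ : ∀ {m} {A : Fin (suc m) → Set} → A fz → ((j : Fin m) → A (fs j)) → (j : Fin (suc m)) → A j
(a ∷ᵈ as) fz     = a
(a ∷ᵈ as) (fs j) = as j

Π-enumerable : ∀ m {A : Fin m → Set} {R : (j : Fin m) → A j → A j → Set} →
               ((j : Fin m) → Enumerable (R j)) → Enumerable (λ f g → ∀ j → R j (f j) (g j))
Π-enumerable m {A} {R} E = record
  { isDecEquivalence = record
    { isEquivalence = record
      { refl  = λ j → Enumerable.refl (E j)
      ; sym   = λ f≈g j → Enumerable.sym (E j) (f≈g j)
      ; trans = λ f≈g g≈h j → Enumerable.trans (E j) (f≈g j) (g≈h j) }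
    ; _≟_ = λ f g → ∀ᶠ? (λ j → Enumerable._≟_ (E j) (f j) (g j)) }
  ; elements = tuples m {A} {R} E
  ; complete = tuples-complete m {A} {R} E }
  where
  tuples : ∀ m {A : Fin m → Set} {R : (j : Fin m) → A j → A j → Set} →
           ((j : Fin m) → Enumerable (R j)) → List ((j : Fin m) → A j)
  tuples zero    E = (λ ()) ∷ []
  tuples (suc m) {A} {R} E =
    cartesianProductWith (_∷ᵈ_ {A = A}) (Enumerable.elements (E fz))
                         (tuples m {A ∘ fs} {R ∘ fs} (E ∘ fs))
  tuples-complete : ∀ m {A : Fin m → Set} {R : (j : Fin m) → A j → A j → Set} →
                    (E : (j : Fin m) → Enumerable (R j)) →
                    (f : (j : Fin m) → A j) → Any (λ g → ∀ j → R j (f j) (g j)) (tuples m E)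
  tuples-complete zero    E f = here (λ ())
  tuples-complete (suc m) {A} {R} E f =
    cartesianProductWith⁺ (_∷ᵈ_ {A = A}) (λ {a} {g} a≈ g≈ → λ { fz → a≈ ; (fs j) → g≈ j })
      (Enumerable.complete (E fz) (f fz)) (tuples-complete m {A ∘ fs} {R ∘ fs} (E ∘ fs) (f ∘ fs))

module Vectors (n : ℕ) where

  vecToFin : ∀ {m} → Vec (Fin n) m → Fin (n ^ m)
  vecToFin []      = fz
  vecToFin (a ∷ v) = combine a (vecToFin v)

  finToVec : ∀ {m} → Fin (n ^ m) → Vec (Fin n) m
  finToVec k = tabulate (finToFun k)

  vecToFin-tabulate : ∀ {m} (f : Fin m → Fin n) → vecToFin (tabulate f) ≡ funToFin f
  vecToFin-tabulate {zero}  f = refl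
  vecToFin-tabulate {suc m} f = cong (combine (f fz)) (vecToFin-tabulate (f ∘ fs))

  vecToFin-finToVec : ∀ {m} (k : Fin (n ^ m)) → vecToFin (finToVec {m} k) ≡ k
  vecToFin-finToVec {m} k = trans (vecToFin-tabulate {m} (finToFun k)) (funToFin-finToFin {m} k)

  finToVec-vecToFin : ∀ {m} (v : Vec (Fin n) m) → finToVec (vecToFin v) ≡ v
  finToVec-vecToFin v = begin
    finToVec (vecToFin v)                   ≡⟨ cong (finToVec ∘ vecToFin) (sym (tabulate∘lookup v)) ⟩
    finToVec (vecToFin (tabulate (lookup v))) ≡⟨ cong finToVec (vecToFin-tabulate (lookup v)) ⟩
    tabulate (finToFun (funToFin (lookup v))) ≡⟨ tabulate-cong (finToFun-funToFin (lookup v)) ⟩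
    tabulate (lookup v)                     ≡⟨ tabulate∘lookup v ⟩
    v                                       ∎
    where open ≡.≡-Reasoning

  allVecs : ∀ m → List (Vec (Fin n) m)
  allVecs m = map finToVec (allFin (n ^ m))

  ∈-allVecs : ∀ {m} (v : Vec (Fin n) m) → v ∈ allVecs m
  ∈-allVecs v = subst (_∈ _) (finToVec-vecToFin v) (∈-map⁺ finToVec (∈-allFin (vecToFin v)))

  length-allVecs : ∀ m → length (allVecs m) ≡ n ^ m
  length-allVecs m = trans (length-map (finToVec {m}) (allFin (n ^ m))) (length-tabulate id)

  vecEnumerable : ∀ m → Enumerable {Vec (Fin n) m} _≡_
  vecEnumerable m = record
    { isDecEquivalence = ≡.isDecEquivalence (≡-dec _≟ᶠ_)
    ; elements = allVecs m
    ; complete = ∈-allVecs }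

module Objects (n : ℕ) where
  open Vectors n

  mutual
    objEnumerable : ∀ k τ → Enumerable (ObjEq n k τ)
    objEnumerable zero    r        = PredicateSpace.functions (vecEnumerable (suc r)) id
    objEnumerable (suc k) (w , ρs) = PredicateSpace.enumerable (tupEnumerable k ρs)

    tupEnumerable : ∀ k {w} (ρs : Vec (Ty k) (suc w)) → Enumerable (TupEq n k ρs)
    tupEnumerable k {w} ρs = Π-enumerable (suc w) (λ j → objEnumerable k (lookup ρs j))

  ≈ᵒ-refl : ∀ {k τ} {R : Obj n k τ} → ObjEq n k τ R R
  ≈ᵒ-refl {k} {τ} = Enumerable.refl (objEnumerable k τ)

  ≈ᵒ-sym : ∀ {k τ} {R S : Obj n k τ} → ObjEq n k τ R S → ObjEq n k τ S R
  ≈ᵒ-sym {k} {τ} = Enumerable.sym (objEnumerable k τ)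

  ≈ᵗ-refl : ∀ {k w} {ρs : Vec (Ty k) (suc w)} {t : Tup n k ρs} → TupEq n k ρs t t
  ≈ᵗ-refl {k} {ρs = ρs} = Enumerable.refl (tupEnumerable k ρs)

  ≈ᵗ-sym : ∀ {k w} {ρs : Vec (Ty k) (suc w)} {t t′ : Tup n k ρs} → TupEq n k ρs t t′ → TupEq n k ρs t′ t
  ≈ᵗ-sym {k} {ρs = ρs} = Enumerable.sym (tupEnumerable k ρs)

  ≈ᵗ-trans : ∀ {k w} {ρs : Vec (Ty k) (suc w)} {t t′ t″ : Tup n k ρs} →
             TupEq n k ρs t t′ → TupEq n k ρs t′ t″ → TupEq n k ρs t t″
  ≈ᵗ-trans {k} {ρs = ρs} = Enumerable.trans (tupEnumerable k ρs)

-- A relation with q parameters p is applied to x via the argument vector p ++ x.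
-- (Custom concatenation, so that arity indices take the form suc (q + r).)

cat : {A : Set} {q r : ℕ} → Vec A q → Vec A (suc r) → Vec A (suc (q + r))
cat []      x = x
cat (a ∷ p) x = a ∷ cat p x

takeParams : {A : Set} (q : ℕ) {r : ℕ} → Vec A (suc (q + r)) → Vec A q
takeParams zero    v       = []
takeParams (suc q) (a ∷ v) = a ∷ takeParams q v

dropParams : {A : Set} (q : ℕ) {r : ℕ} → Vec A (suc (q + r)) → Vec A (suc r)
dropParams zero    v       = v
dropParams (suc q) (a ∷ v) = dropParams q v

takeParams-cat : {A : Set} {q r : ℕ} (p : Vec A q) (x : Vec A (suc r)) → takeParams q (cat p x) ≡ p
takeParams-cat []      x = refl
takeParams-cat (a ∷ p) x = cong (a ∷_) (takeParams-cat p x)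

dropParams-cat : {A : Set} {q r : ℕ} (p : Vec A q) (x : Vec A (suc r)) → dropParams q (cat p x) ≡ x
dropParams-cat []      x = refl
dropParams-cat (a ∷ p) x = dropParams-cat p x

map-cat : {A B : Set} (f : A → B) {q r : ℕ} (p : Vec A q) (x : Vec A (suc r)) →
          Vec.map f (cat p x) ≡ cat (Vec.map f p) (Vec.map f x)
map-cat f []      x = refl
map-cat f (a ∷ p) x = cong (f a ∷_) (map-cat f p x)

-- The shape of a code, with slots F a for (a+1)-ary relations.  A (k+2)-th order
-- object of type τ, with q parameters and tuples indexed by (d+1)-vectors, is coded by
--   order 2 (arity r+1):   one relation of arity q+r+1;
--   order k+3, type ρs:    a selector of arity q+d+1 and, for each component j, a code
--                          of type ρs j with the q+d+1 parameters p ++ y.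
-- The object coded with parameters p is then the set of tuples indexed by the y
-- with S (p ++ y), the j-th entry of the tuple at y being the decoded component j.
mutual
  Shape : (ℕ → Set) → (k : ℕ) → Ty k → ℕ → ℕ → Set
  Shape F zero    r        d q = F (q + r)
  Shape F (suc k) (w , ρs) d q = F (q + d) × Shapes F k ρs d (suc (q + d))

  Shapes : (ℕ → Set) → (k : ℕ) {m : ℕ} → Vec (Ty k) m → ℕ → ℕ → Set
  Shapes F k []       d q = ⊤
  Shapes F k (ρ ∷ ρs) d q = Shape F k ρ d q × Shapes F k ρs d q

module _ {F : ℕ → Set} where

  component : ∀ k {m} {ρs : Vec (Ty k) m} {d q} → Shapes F k ρs d q →
              (j : Fin m) → Shape F k (lookup ρs j) d q
  component k {ρs = ρ ∷ ρs} (c , cs) fz     = c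
  component k {ρs = ρ ∷ ρs} (c , cs) (fs j) = component k cs j

  tabulateShapes : ∀ k {m} (ρs : Vec (Ty k) m) {d q} →
                   ((j : Fin m) → Shape F k (lookup ρs j) d q) → Shapes F k ρs d q
  tabulateShapes k []       f = tt
  tabulateShapes k (ρ ∷ ρs) f = f fz , tabulateShapes k ρs (f ∘ fs)

  component-tabulate : ∀ k {m} (ρs : Vec (Ty k) m) {d q} (f : (j : Fin m) → Shape F k (lookup ρs j) d q) j →
                       component k (tabulateShapes k ρs f) j ≡ f j
  component-tabulate k (ρ ∷ ρs) f fz     = refl
  component-tabulate k (ρ ∷ ρs) f (fs j) = component-tabulate k ρs (f ∘ fs) j

mutual
  mapShape : {F G : ℕ → Set} → (∀ a → F a → G a) → ∀ k τ d q → Shape F k τ d q → Shape G k τ d q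
  mapShape f zero    r        d q c        = f (q + r) c
  mapShape f (suc k) (w , ρs) d q (S , cs) = f (q + d) S , mapShapes f k ρs d (suc (q + d)) cs

  mapShapes : {F G : ℕ → Set} → (∀ a → F a → G a) →
              ∀ k {m} (ρs : Vec (Ty k) m) d q → Shapes F k ρs d q → Shapes G k ρs d q
  mapShapes f k []       d q tt       = tt
  mapShapes f k (ρ ∷ ρs) d q (c , cs) = mapShape f k ρ d q c , mapShapes f k ρs d q cs

mutual
  mapShape-fusion : {F G H : ℕ → Set} (f : ∀ a → G a → H a) (g : ∀ a → F a → G a)
                    (h : ∀ a → F a → H a) → (∀ a (x : F a) → f a (g a x) ≡ h a x) →
                    ∀ k τ d q c → mapShape f k τ d q (mapShape g k τ d q c) ≡ mapShape h k τ d q c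
  mapShape-fusion f g h fg≡h zero    r        d q c        = fg≡h (q + r) c
  mapShape-fusion f g h fg≡h (suc k) (w , ρs) d q (S , cs) =
    cong₂ _,_ (fg≡h (q + d) S) (mapShapes-fusion f g h fg≡h k ρs d (suc (q + d)) cs)

  mapShapes-fusion : {F G H : ℕ → Set} (f : ∀ a → G a → H a) (g : ∀ a → F a → G a)
                     (h : ∀ a → F a → H a) → (∀ a (x : F a) → f a (g a x) ≡ h a x) →
                     ∀ k {m} (ρs : Vec (Ty k) m) d q cs →
                     mapShapes f k ρs d q (mapShapes g k ρs d q cs) ≡ mapShapes h k ρs d q cs
  mapShapes-fusion f g h fg≡h k []       d q tt       = refl
  mapShapes-fusion f g h fg≡h k (ρ ∷ ρs) d q (c , cs) =
    cong₂ _,_ (mapShape-fusion f g h fg≡h k ρ d q c) (mapShapes-fusion f g h fg≡h k ρs d q cs)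

component-map : {F G : ℕ → Set} (f : ∀ a → F a → G a) → ∀ k {m} (ρs : Vec (Ty k) m) d q cs j →
                component k (mapShapes f k ρs d q cs) j ≡ mapShape f k (lookup ρs j) d q (component k cs j)
component-map f k (ρ ∷ ρs) d q (c , cs) fz     = refl
component-map f k (ρ ∷ ρs) d q (c , cs) (fs j) = component-map f k ρs d q cs j

module Coding (n : ℕ) where
  open Vectors n
  open Objects n

  Rel : ℕ → Set
  Rel a = Vec (Fin n) (suc a) → Bool

  Code : (k : ℕ) → Ty k → ℕ → ℕ → Set
  Code = Shape Rel

  Codes : (k : ℕ) {m : ℕ} → Vec (Ty k) m → ℕ → ℕ → Set
  Codes = Shapes Rel

  _≟ᵗ_ : ∀ {k w} {ρs : Vec (Ty k) (suc w)} (t t′ : Tup n k ρs) → Dec (TupEq n k ρs t t′)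
  _≟ᵗ_ {k} {ρs = ρs} = Enumerable._≟_ (tupEnumerable k ρs)

  mutual
    decode : ∀ k τ d {q} → Code k τ d q → Vec (Fin n) q → Obj n k τ
    decode zero    r        d R        p = λ x → R (cat p x)
    decode (suc k) (w , ρs) d (S , cs) p =
      (λ t → does (indexed? k ρs d S cs p t)) ,
      (λ t t′ t≈t′ → does-⇔ (indexed-resp k ρs d S cs p t≈t′)
                            (indexed? k ρs d S cs p t) (indexed? k ρs d S cs p t′))

    entry : ∀ k {w} (ρs : Vec (Ty k) (suc w)) d {q} → Codes k ρs d (suc (q + d)) →
            Vec (Fin n) q → Vec (Fin n) (suc d) → Tup n k ρs
    entry k ρs d cs p y j = decode k (lookup ρs j) d (component k cs j) (cat p y)

    Indexed : ∀ k {w} (ρs : Vec (Ty k) (suc w)) d {q} → Rel (q + d) → Codes k ρs d (suc (q + d)) →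
              Vec (Fin n) q → Tup n k ρs → Set
    Indexed k ρs d S cs p t =
      Σ (Vec (Fin n) (suc d)) λ y → (S (cat p y) ≡ true) × TupEq n k ρs t (entry k ρs d cs p y)

    indexed? : ∀ k {w} (ρs : Vec (Ty k) (suc w)) d {q} S cs p t → Dec (Indexed k ρs d {q} S cs p t)
    indexed? k ρs d S cs p t = ∃? (allVecs (suc d)) ∈-allVecs λ y →
      (S (cat p y) Bool.≟ true) ×-dec (_≟ᵗ_ {ρs = ρs} t (entry k ρs d cs p y))

    indexed-resp : ∀ k {w} (ρs : Vec (Ty k) (suc w)) d {q} S cs p {t t′} → TupEq n k ρs t t′ →
                   Indexed k ρs d {q} S cs p t ⇔ Indexed k ρs d S cs p t′
    indexed-resp k ρs d S cs p t≈t′ =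
      mk⇔ (λ (y , s , t≈e) → y , s , ≈ᵗ-trans {ρs = ρs} (≈ᵗ-sym {ρs = ρs} t≈t′) t≈e)
          (λ (y , s , t′≈e) → y , s , ≈ᵗ-trans {ρs = ρs} t≈t′ t′≈e)

  decode-∈ : ∀ k {w} (ρs : Vec (Ty k) (suc w)) d {q} S cs (p : Vec (Fin n) q) t →
             (proj₁ (decode (suc k) (w , ρs) d (S , cs) p) t ≡ true) ⇔ Indexed k ρs d S cs p t
  decode-∈ k ρs d S cs p t = mk⇔ (from-does (indexed? k ρs d S cs p t)) (dec-true (indexed? k ρs d S cs p t))

  AtMost-resp : ∀ N k τ (R R′ : Obj n (suc k) τ) → ObjEq n (suc k) τ R R′ →
                AtMost n N k τ R → AtMost n N k τ R′
  AtMost-resp N k (w , ρs) R R′ R≈R′ (L , len≤ , covers) =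
    L , len≤ , λ t t∈R′ → covers t (trans (R≈R′ t) t∈R′)

  DPB-resp : ∀ d k τ (R R′ : Obj n (suc k) τ) → ObjEq n (suc k) τ R R′ → DPB n d k τ R → DPB n d k τ R′
  DPB-resp d zero    τ        R R′ R≈R′ bounded = AtMost-resp (n ^ d) zero τ R R′ R≈R′ bounded
  DPB-resp d (suc k) (w , ρs) R R′ R≈R′ (atMost , inner) =
    AtMost-resp (n ^ d) (suc k) (w , ρs) R R′ R≈R′ atMost , λ t t∈R′ → inner t (trans (R≈R′ t) t∈R′)

  DPB⇒AtMost : ∀ d k τ {R : Obj n (suc k) τ} → DPB n d k τ R → AtMost n (n ^ d) k τ R
  DPB⇒AtMost d zero    τ bounded = bounded
  DPB⇒AtMost d (suc k) τ bounded = proj₁ bounded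

  -- A decoded relation is listed by its entries at all n^(d+1) indices.
  decode-AtMost : ∀ k {w} (ρs : Vec (Ty k) (suc w)) d {q} S cs (p : Vec (Fin n) q) →
                  AtMost n (n ^ suc d) k (w , ρs) (decode (suc k) (w , ρs) d (S , cs) p)
  decode-AtMost k ρs d S cs p =
    map (entry k ρs d cs p) (allVecs (suc d)) ,
    ≤-reflexive (trans (length-map _ (allVecs (suc d))) (length-allVecs (suc d))) ,
    λ t t∈ → let (y , _ , t≈e) = to (decode-∈ k ρs d S cs p t) t∈ in map⁺ (lose (∈-allVecs y) t≈e)

  decode-DPB : ∀ k τ d {q} (c : Code (suc k) τ d q) p → DPB n (suc d) k τ (decode (suc k) τ d c p)
  decode-DPB zero    (w , ρs) d (S , cs) p = decode-AtMost zero ρs d S cs p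
  decode-DPB (suc k) (w , ρs) d (S , cs) p =
    decode-AtMost (suc k) ρs d S cs p ,
    λ t t∈ j → let (y , _ , t≈e) = to (decode-∈ (suc k) ρs d S cs p t) t∈ in
      DPB-resp (suc d) k (lookup ρs j) (entry (suc k) ρs d cs p y j) (t j)
               (≈ᵒ-sym {suc k} {lookup ρs j} {t j} {entry (suc k) ρs d cs p y j} (t≈e j))
               (decode-DPB k (lookup ρs j) d (component (suc k) cs j) (cat p y))

  ∅ : ∀ k τ → Obj n k τ
  ∅ zero    r = λ _ → false
  ∅ (suc k) τ = (λ _ → false) , (λ _ _ _ → refl)

  ∅-DPB : ∀ d k τ → DPB n d k τ (∅ (suc k) τ)
  ∅-DPB d zero    τ = [] , z≤n , λ t ()
  ∅-DPB d (suc k) τ = ([] , z≤n , λ t ()) , λ t ()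

  -- Families of objects (indexed by parameter vectors) that codes with index length d+1
  -- can describe: second order ones, and those downward polynomially bounded by d+1.
  Codable : ∀ d k τ {q} → (Vec (Fin n) q → Obj n k τ) → Set
  Codable d zero    τ F = ⊤
  Codable d (suc k) τ F = ∀ p → DPB n (suc d) k τ (F p)

  nth : {A : Set} → A → List A → ℕ → A
  nth a₀ []       i       = a₀
  nth a₀ (a ∷ as) zero    = a
  nth a₀ (a ∷ as) (suc i) = nth a₀ as i

  nth-lookup : {A : Set} (a₀ : A) (as : List A) (i : Fin (length as)) → nth a₀ as (toℕ i) ≡ List.lookup as i
  nth-lookup a₀ (a ∷ as) fz     = refl
  nth-lookup a₀ (a ∷ as) (fs i) = nth-lookup a₀ as i

  -- Storing a bounded family of relations: for parameters p, the tuples of F p are listed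
  -- (at most n^(d+1) of them) and the one with number y is stored at index y.
  module Store {k w} {ρs : Vec (Ty k) (suc w)} d {q} (F : Vec (Fin n) q → Obj n (suc k) (w , ρs))
               (bounded : ∀ p → DPB n (suc d) k (w , ρs) (F p)) where

    ∅ᵗ : Tup n k ρs
    ∅ᵗ j = ∅ k (lookup ρs j)

    listing : ∀ p → AtMost n (n ^ suc d) k (w , ρs) (F p)
    listing p = DPB⇒AtMost (suc d) k (w , ρs) (bounded p)

    select : Obj n (suc k) (w , ρs) → Tup n k ρs → Tup n k ρs
    select R t = if proj₁ R t then t else ∅ᵗ

    select-∈ : ∀ R t → proj₁ R t ≡ true → select R t ≡ t
    select-∈ R t t∈R rewrite t∈R = refl

    stored : Vec (Fin n) q → Vec (Fin n) (suc d) → Tup n k ρs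
    stored p y = select (F p) (nth ∅ᵗ (proj₁ (listing p)) (toℕ (vecToFin y)))

    stored-complete : ∀ p t → proj₁ (F p) t ≡ true →
                      Σ (Vec (Fin n) (suc d)) λ y → TupEq n k ρs t (stored p y) × (proj₁ (F p) (stored p y) ≡ true)
    stored-complete p t t∈ =
      y , subst (TupEq n k ρs t) (sym stored≡u) t≈u , subst (λ u′ → proj₁ (F p) u′ ≡ true) (sym stored≡u) u∈
      where
      L = proj₁ (listing p)
      t∈L : Any (TupEq n k ρs t) L
      t∈L = proj₂ (proj₂ (listing p)) t t∈
      i = Any.index t∈L
      u = List.lookup L i
      t≈u : TupEq n k ρs t u
      t≈u = lookup-index t∈L
      u∈ : proj₁ (F p) u ≡ true
      u∈ = trans (sym (proj₂ (F p) t u t≈u)) t∈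
      i′ = inject≤ i (proj₁ (proj₂ (listing p)))
      y = finToVec i′
      stored≡u : stored p y ≡ u
      stored≡u = begin
        select (F p) (nth ∅ᵗ L (toℕ (vecToFin y)))
          ≡⟨ cong (λ k′ → select (F p) (nth ∅ᵗ L (toℕ k′))) (vecToFin-finToVec {suc d} i′) ⟩
        select (F p) (nth ∅ᵗ L (toℕ (inject≤ i _)))
          ≡⟨ cong (λ m → select (F p) (nth ∅ᵗ L m)) (toℕ-inject≤ i _) ⟩
        select (F p) (nth ∅ᵗ L (toℕ i))
          ≡⟨ cong (select (F p)) (nth-lookup ∅ᵗ L i) ⟩
        select (F p) u
          ≡⟨ select-∈ (F p) u u∈ ⟩
        u ∎
        where open ≡.≡-Reasoning

    stored-cases : ∀ p y → (proj₁ (F p) (stored p y) ≡ true) ⊎ (stored p y ≡ ∅ᵗ)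
    stored-cases p y with proj₁ (F p) (nth ∅ᵗ (proj₁ (listing p)) (toℕ (vecToFin y))) in t∈
    ... | true  = inj₁ t∈
    ... | false = inj₂ refl

  member-or-∅-DPB : ∀ d k {w} {ρs : Vec (Ty (suc k)) (suc w)} (R : Obj n (suc (suc k)) (w , ρs)) →
                    DPB n d (suc k) (w , ρs) R →
                    ∀ t → (proj₁ R t ≡ true) ⊎ (t ≡ λ j → ∅ (suc k) (lookup ρs j)) →
                    ∀ j → DPB n d k (lookup ρs j) (t j)
  member-or-∅-DPB d k R bounded t (inj₁ t∈R) j = proj₂ bounded t t∈R j
  member-or-∅-DPB d k {ρs = ρs} R bounded t (inj₂ refl) j = ∅-DPB d k (lookup ρs j)

  stored-codable : ∀ d k {w} {ρs : Vec (Ty k) (suc w)} {q} F bounded j →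
                   Codable d k (lookup ρs j) (λ v → Store.stored {k} {w} {ρs} d {q} F bounded
                                                      (takeParams q v) (dropParams q v) j)
  stored-codable d zero    F bounded j = tt
  stored-codable d (suc k) {ρs = ρs} {q} F bounded j v =
    member-or-∅-DPB (suc d) k {ρs = ρs} (F p) (bounded p) (stored p y) (stored-cases p y) j
    where
    open Store {suc k} {ρs = ρs} d {q} F bounded
    p = takeParams q v
    y = dropParams q v

  encode : ∀ k τ d q (F : Vec (Fin n) q → Obj n k τ) → Codable d k τ F →
           Σ (Code k τ d q) λ c → ∀ p → ObjEq n k τ (decode k τ d c p) (F p)
  encode zero r d q F _ =
    (λ v → F (takeParams q v) (dropParams q v)) ,
    λ p x → cong₂ F (takeParams-cat p x) (dropParams-cat p x)
  encode (suc k) (w , ρs) d q F bounded = (selector , cs) , decode≈F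
    where
    open Store d F bounded

    selector : Rel (q + d)
    selector v = proj₁ (F (takeParams q v)) (stored (takeParams q v) (dropParams q v))

    selector-cat : ∀ p y → selector (cat p y) ≡ proj₁ (F p) (stored p y)
    selector-cat p y = cong₂ (λ p′ y′ → proj₁ (F p′) (stored p′ y′)) (takeParams-cat p y) (dropParams-cat p y)

    components : ∀ j → Σ (Code k (lookup ρs j) d (suc (q + d))) λ c →
                   ∀ v → ObjEq n k (lookup ρs j) (decode k (lookup ρs j) d c v) (stored (takeParams q v) (dropParams q v) j)
    components j = encode k (lookup ρs j) d (suc (q + d)) _ (stored-codable d k F bounded j)

    cs : Codes k ρs d (suc (q + d))
    cs = tabulateShapes k ρs (proj₁ ∘ components)

    entry≈stored : ∀ p y → TupEq n k ρs (entry k ρs d cs p y) (stored p y)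
    entry≈stored p y j =
      subst₂ (ObjEq n k (lookup ρs j))
             (cong (λ c → decode k (lookup ρs j) d c (cat p y)) (sym (component-tabulate k ρs (proj₁ ∘ components) j)))
             (cong₂ (λ p′ y′ → stored p′ y′ j) (takeParams-cat p y) (dropParams-cat p y))
             (proj₂ (components j) (cat p y))

    decode≈F : ∀ p → ObjEq n (suc k) (w , ρs) (decode (suc k) (w , ρs) d (selector , cs) p) (F p)
    decode≈F p t = bool-ext (⇔-trans (decode-∈ k ρs d selector cs p t) (mk⇔ indexed⇒∈ ∈⇒indexed))
      where
      indexed⇒∈ : Indexed k ρs d selector cs p t → proj₁ (F p) t ≡ true
      indexed⇒∈ (y , selected , t≈e) =
        trans (proj₂ (F p) t (stored p y) (≈ᵗ-trans {ρs = ρs} t≈e (entry≈stored p y)))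
              (trans (sym (selector-cat p y)) selected)
      ∈⇒indexed : proj₁ (F p) t ≡ true → Indexed k ρs d selector cs p t
      ∈⇒indexed t∈ =
        let (y , t≈s , s∈) = stored-complete p t t∈
        in y , trans (selector-cat p y) s∈ , ≈ᵗ-trans {ρs = ρs} t≈s (≈ᵗ-sym {ρs = ρs} (entry≈stored p y))

  code-complete : ∀ k τ d (R : Obj n (suc k) τ) → DPB n (suc d) k τ R →
                  Σ (Code (suc k) τ d 0) λ c → ObjEq n (suc k) τ (decode (suc k) τ d c []) R
  code-complete k τ d R bounded =
    let (c , c≈R) = encode (suc k) τ d 0 (λ _ → R) (λ _ → bounded) in c , c≈R []

  Included : ∀ k τ → Obj n (suc k) τ → Obj n (suc k) τ → Set
  Included k (w , ρs) R S = ∀ t → proj₁ R t ≡ true → proj₁ S t ≡ true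

  ≈⇔⊆⊇ : ∀ k τ (R S : Obj n (suc k) τ) → ObjEq n (suc k) τ R S ⇔ (Included k τ R S × Included k τ S R)
  ≈⇔⊆⊇ k (w , ρs) R S =
    mk⇔ (λ R≈S → (λ t t∈ → trans (sym (R≈S t)) t∈) , (λ t t∈ → trans (R≈S t) t∈))
        (λ (R⊆S , S⊆R) t → bool-ext (mk⇔ (R⊆S t) (S⊆R t)))

  decode-⊆ : ∀ k {w} (ρs : Vec (Ty k) (suc w)) d {q} S cs (p : Vec (Fin n) q) (R : Obj n (suc k) (w , ρs)) →
             Included k (w , ρs) (decode (suc k) (w , ρs) d (S , cs) p) R ⇔
             (∀ y → S (cat p y) ≡ true → proj₁ R (entry k ρs d cs p y) ≡ true)
  decode-⊆ k ρs d S cs p R =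
    mk⇔ (λ ⊆R y s → ⊆R (entry k ρs d cs p y) (from (decode-∈ k ρs d S cs p _) (y , s , ≈ᵗ-refl {ρs = ρs})))
        (λ entries∈R t t∈ → let (y , s , t≈e) = to (decode-∈ k ρs d S cs p t) t∈
                            in trans (proj₂ R t _ t≈e) (entries∈R y s))

Wk : Ctx → Ctx → Set
Wk Γ Δ = ∀ {s} → s ∈ Γ → s ∈ Δ

CodeVar : Ctx → (k : ℕ) → Ty k → ℕ → ℕ → Set
CodeVar Δ = Shape (λ a → so a ∈ Δ)

wkCode : ∀ {Δ Δ′} → Wk Δ Δ′ → ∀ k τ d q → CodeVar Δ k τ d q → CodeVar Δ′ k τ d q
wkCode w = mapShape (λ _ → w)

-- An object described in the variables of Δ: a code together with first order
-- variables holding its parameters.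
record Coded (Δ : Ctx) (k : ℕ) (τ : Ty k) : Set where
  constructor coded
  field
    bound  : ℕ    -- tuples are indexed by vectors of length bound + 1
    params : ℕ
    code   : CodeVar Δ k τ bound params
    args   : Vec (fo ∈ Δ) params

wkCoded : ∀ {Δ Δ′} → Wk Δ Δ′ → ∀ {k τ} → Coded Δ k τ → Coded Δ′ k τ
wkCoded w {k} {τ} (coded d q c p) = coded d q (wkCode w k τ d q c) (Vec.map w p)

module Formulae (σ : Vocab) where

  SO : Ctx → Set
  SO = Form σ 2

  2≤2 : 2 ≤ 2
  2≤2 = s≤s (s≤s z≤n)

  -- A formula in every extension of Δ, depending on a value of a syntactic kind V.
  Scope : (Ctx → Set) → Ctx → Set
  Scope V Δ = ∀ {Δ′} → Wk Δ Δ′ → V Δ′ → SO Δ′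

  quant1 : ∀ {Δ} → Quant → SO (fo ∷ Δ) → SO Δ
  quant1 ∃Q = ex1
  quant1 ∀Q = all1

  quant2 : ∀ {Δ} → Quant → ∀ r → SO (so r ∷ Δ) → SO Δ
  quant2 ∃Q r = ex2 r 2≤2
  quant2 ∀Q r = all2 r 2≤2

  FOVars : ℕ → Ctx → Set
  FOVars m Δ = Vec (fo ∈ Δ) m

  quantVars : ∀ {Δ} → Quant → ∀ m → Scope (FOVars m) Δ → SO Δ
  quantVars q zero    K = K id []
  quantVars q (suc m) K = quant1 q (quantVars q m λ w xs → K (w ∘ there) (w (here refl) ∷ xs))

  mutual
    quantCode : ∀ {Δ} → Quant → ∀ k τ d q → Scope (λ Δ′ → CodeVar Δ′ k τ d q) Δ → SO Δ
    quantCode Q zero    r        d q K = quant2 Q (q + r) (K there (here refl))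
    quantCode Q (suc k) (w , ρs) d q K =
      quant2 Q (q + d) (quantCodes Q k ρs d (suc (q + d)) λ w′ cs → K (w′ ∘ there) (w′ (here refl) , cs))

    quantCodes : ∀ {Δ} → Quant → ∀ k {m} (ρs : Vec (Ty k) m) d q →
                 Scope (λ Δ′ → Shapes (λ a → so a ∈ Δ′) k ρs d q) Δ → SO Δ
    quantCodes Q k []       d q K = K id tt
    quantCodes Q k (ρ ∷ ρs) d q K =
      quantCode Q k ρ d q λ w c → quantCodes Q k ρs d q λ w′ cs → K (w′ ∘ w) (wkCode w′ k ρ d q c , cs)

  conj : ∀ {Δ} w → (Fin (suc w) → SO Δ) → SO Δ
  conj zero    φ = φ fz
  conj (suc w) φ = and (φ fz) (conj w (φ ∘ fs))

  _⇒ᶠ_ : ∀ {Δ} → SO Δ → SO Δ → SO Δ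
  φ ⇒ᶠ ψ = or (neg φ) ψ

  _⇔ᶠ_ : ∀ {Δ} → SO Δ → SO Δ → SO Δ
  φ ⇔ᶠ ψ = or (and φ ψ) (and (neg φ) (neg ψ))

  applyᶠ : ∀ {Δ q r} → so (q + r) ∈ Δ → FOVars q Δ → FOVars (suc r) Δ → SO Δ
  applyᶠ X p x = app2 X (cat p x)

  entryᶠ : ∀ {Δ} k {w} (ρs : Vec (Ty k) (suc w)) d {q} → Shapes (λ a → so a ∈ Δ) k ρs d (suc (q + d)) →
           FOVars q Δ → FOVars (suc d) Δ → (j : Fin (suc w)) → Coded Δ k (lookup ρs j)
  entryᶠ k ρs d {q} cs p y j = coded d (suc (q + d)) (component k cs j) (cat p y)

  sameAt : ∀ {Δ q₁ q₂ r} → so (q₁ + r) ∈ Δ → FOVars q₁ Δ → so (q₂ + r) ∈ Δ → FOVars q₂ Δ →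
           Scope (FOVars (suc r)) Δ
  sameAt X₁ p₁ X₂ p₂ w x = applyᶠ (w X₁) (Vec.map w p₁) x ⇔ᶠ applyᶠ (w X₂) (Vec.map w p₂) x

  mutual
    Eqᶠ : ∀ {Δ} k τ → Coded Δ k τ → Coded Δ k τ → SO Δ
    Eqᶠ zero    r        (coded _ _ X₁ p₁) (coded _ _ X₂ p₂) = quantVars ∀Q (suc r) (sameAt X₁ p₁ X₂ p₂)
    Eqᶠ (suc k) (w , ρs) a b = and (Inclᶠ k ρs a b) (Inclᶠ k ρs b a)

    Inclᶠ : ∀ {Δ} k {w} (ρs : Vec (Ty k) (suc w)) → Coded Δ (suc k) (w , ρs) → Coded Δ (suc k) (w , ρs) → SO Δ
    Inclᶠ k ρs (coded d q (S , cs) p) b = quantVars ∀Q (suc d) (entryIn k ρs d S cs p b)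

    Indexedᶠ : ∀ {Δ} k {w} (ρs : Vec (Ty k) (suc w)) → Coded Δ (suc k) (w , ρs) →
               ((j : Fin (suc w)) → Coded Δ k (lookup ρs j)) → SO Δ
    Indexedᶠ k ρs (coded d q (S , cs) p) ts = quantVars ∃Q (suc d) (indexes k ρs d S cs p ts)

    entryIn : ∀ {Δ} k {w} (ρs : Vec (Ty k) (suc w)) d {q} → so (q + d) ∈ Δ →
              Shapes (λ a → so a ∈ Δ) k ρs d (suc (q + d)) → FOVars q Δ →
              Coded Δ (suc k) (w , ρs) → Scope (FOVars (suc d)) Δ
    entryIn k ρs d S cs p b w y =
      applyᶠ (w S) (Vec.map w p) y ⇒ᶠ
      Indexedᶠ k ρs (wkCoded w b) (entryᶠ k ρs d (mapShapes (λ _ → w) k ρs d _ cs) (Vec.map w p) y)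

    indexes : ∀ {Δ} k {w} (ρs : Vec (Ty k) (suc w)) d {q} → so (q + d) ∈ Δ →
              Shapes (λ a → so a ∈ Δ) k ρs d (suc (q + d)) → FOVars q Δ →
              ((j : Fin (suc w)) → Coded Δ k (lookup ρs j)) → Scope (FOVars (suc d)) Δ
    indexes k {w} ρs d S cs p ts w′ z =
      and (applyᶠ (w′ S) (Vec.map w′ p) z)
          (conj w λ j → Eqᶠ k (lookup ρs j) (wkCoded w′ (ts j))
                             (entryᶠ k ρs d (mapShapes (λ _ → w′) k ρs d _ cs) (Vec.map w′ p) z j))

module Semantics {σ : Vocab} (A : Structure σ) where
  open Formulae σ
  open Objects (n A)
  open Coding (n A)

  record Ext {Δ Δ′} (w : Wk Δ Δ′) (e : Env (n A) Δ) (e′ : Env (n A) Δ′) : Set where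
    constructor extends
    field
      at : ∀ {s} (x : s ∈ Δ) → All.lookup e′ (w x) ≡ All.lookup e x
  open Ext public

  Ext-∘ : ∀ {Δ Δ′ Δ″} {w : Wk Δ Δ′} {w′ : Wk Δ′ Δ″} {e e′ e″} →
          Ext w e e′ → Ext w′ e′ e″ → Ext (w′ ∘ w) e e″
  Ext-∘ {w = w} ext ext′ = extends λ x → trans (at ext′ (w x)) (at ext x)

  valVars : ∀ {Δ m} → Env (n A) Δ → FOVars m Δ → Vec (Fin (n A)) m
  valVars e = Vec.map (All.lookup e)

  valVars-wk : ∀ {Δ Δ′} {w : Wk Δ Δ′} {e e′} → Ext w e e′ → ∀ {m} (p : FOVars m Δ) →
               valVars e′ (Vec.map w p) ≡ valVars e p
  valVars-wk ext []      = refl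
  valVars-wk ext (x ∷ p) = cong₂ _∷_ (at ext x) (valVars-wk ext p)

  valCode : ∀ {Δ} → Env (n A) Δ → ∀ k τ d q → CodeVar Δ k τ d q → Code k τ d q
  valCode e = mapShape (λ _ → All.lookup e)

  valCodes : ∀ {Δ} → Env (n A) Δ → ∀ k {m} (ρs : Vec (Ty k) m) d q →
             Shapes (λ a → so a ∈ Δ) k ρs d q → Codes k ρs d q
  valCodes e = mapShapes (λ _ → All.lookup e)

  valCode-wk : ∀ {Δ Δ′} {w : Wk Δ Δ′} {e e′} → Ext w e e′ → ∀ k τ d q (c : CodeVar Δ k τ d q) →
               valCode e′ k τ d q (wkCode w k τ d q c) ≡ valCode e k τ d q c
  valCode-wk {w = w} {e} {e′} ext =
    mapShape-fusion (λ _ → All.lookup e′) (λ _ → w) (λ _ → All.lookup e) (λ _ → at ext)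

  ⟦_⟧ᶜ : ∀ {Δ k τ} → Coded Δ k τ → Env (n A) Δ → Obj (n A) k τ
  ⟦_⟧ᶜ {k = k} {τ} (coded d q c p) e = decode k τ d (valCode e k τ d q c) (valVars e p)

  ⟦⟧ᶜ-wk : ∀ {Δ Δ′} {w : Wk Δ Δ′} {e e′} → Ext w e e′ → ∀ {k τ} (a : Coded Δ k τ) →
           ⟦ wkCoded w a ⟧ᶜ e′ ≡ ⟦ a ⟧ᶜ e
  ⟦⟧ᶜ-wk ext {k} {τ} (coded d q c p) = cong₂ (decode k τ d) (valCode-wk ext k τ d q c) (valVars-wk ext p)

  ⟦entryᶠ⟧ : ∀ {Δ Δ′} {w : Wk Δ Δ′} {e e′} → Ext w e e′ →
             ∀ k {w′} (ρs : Vec (Ty k) (suc w′)) d {q} cs (p : FOVars q Δ) (y : FOVars (suc d) Δ′) j →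
             ⟦ entryᶠ k ρs d (mapShapes (λ _ → w) k ρs d _ cs) (Vec.map w p) y j ⟧ᶜ e′ ≡
             entry k ρs d (valCodes e k ρs d _ cs) (valVars e p) (valVars e′ y) j
  ⟦entryᶠ⟧ {w = w} {e} {e′} ext k ρs d {q} cs p y j =
    cong₂ (decode k (lookup ρs j) d) component≡ params≡
    where
    component≡ : valCode e′ k (lookup ρs j) d _ (component k (mapShapes (λ _ → w) k ρs d _ cs) j) ≡
                 component k (valCodes e k ρs d _ cs) j
    component≡ = begin
      valCode e′ k (lookup ρs j) d _ (component k (mapShapes (λ _ → w) k ρs d _ cs) j)
        ≡⟨ cong (valCode e′ k (lookup ρs j) d _) (component-map (λ _ → w) k ρs d _ cs j) ⟩
      valCode e′ k (lookup ρs j) d _ (wkCode w k (lookup ρs j) d _ (component k cs j))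
        ≡⟨ valCode-wk ext k (lookup ρs j) d _ (component k cs j) ⟩
      valCode e k (lookup ρs j) d _ (component k cs j)
        ≡⟨ sym (component-map (λ _ → All.lookup e) k ρs d _ cs j) ⟩
      component k (valCodes e k ρs d _ cs) j
        ∎
      where open ≡.≡-Reasoning
    params≡ : valVars e′ (cat (Vec.map w p) y) ≡ cat (valVars e p) (valVars e′ y)
    params≡ = trans (map-cat (All.lookup e′) (Vec.map w p) y)
                    (cong (λ p′ → cat p′ (valVars e′ y)) (valVars-wk ext p))

  applyᶠ-sem : ∀ {Δ Δ′} {w : Wk Δ Δ′} {e e′} → Ext w e e′ →
               ∀ {q r} (X : so (q + r) ∈ Δ) (p : FOVars q Δ) (x : FOVars (suc r) Δ′) →
               Sat A e′ (applyᶠ (w X) (Vec.map w p) x) ⇔ (All.lookup e X (cat (valVars e p) (valVars e′ x)) ≡ true)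
  applyᶠ-sem {w = w} {e} {e′} ext X p x =
    ≡⇒⇔ (cong (_≡ true) (cong₂ (λ R v → R v) (at ext X)
         (trans (map-cat (All.lookup e′) (Vec.map w p) x) (cong (λ p′ → cat p′ (valVars e′ x)) (valVars-wk ext p)))))

  quant1-sem : ∀ {Δ} (e : Env (n A) Δ) Q (φ : SO (fo ∷ Δ)) →
               Sat A e (quant1 Q φ) ⇔ ⟦ Q ⟧ (Fin (n A)) λ a → Sat A (a All.∷ e) φ
  quant1-sem e ∃Q φ = ⇔-id _
  quant1-sem e ∀Q φ = ⇔-id _

  quant2-sem : ∀ {Δ} (e : Env (n A) Δ) Q r (φ : SO (so r ∷ Δ)) →
               Sat A e (quant2 Q r φ) ⇔ ⟦ Q ⟧ (Rel r) λ R → Sat A (R All.∷ e) φ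
  quant2-sem e ∃Q r φ = ⇔-id _
  quant2-sem e ∀Q r φ = ⇔-id _

  conj-sem : ∀ {Δ} (e : Env (n A) Δ) w (φ : Fin (suc w) → SO Δ) (P : Fin (suc w) → Set) →
             (∀ j → Sat A e (φ j) ⇔ P j) → Sat A e (conj w φ) ⇔ (∀ j → P j)
  conj-sem e zero    φ P h = ⇔-trans (h fz) (mk⇔ (λ p → λ { fz → p }) (λ f → f fz))
  conj-sem e (suc w) φ P h =
    ⇔-trans (h fz ×-⇔ conj-sem e w (φ ∘ fs) (P ∘ fs) (h ∘ fs))
            (mk⇔ (λ (p , ps) → p ∷ᵈ ps) (λ f → f fz , f ∘ fs))

  ⇒ᶠ-sem : ∀ {Δ} (e : Env (n A) Δ) (φ ψ : SO Δ) → Dec (Sat A e φ) →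
           Sat A e (φ ⇒ᶠ ψ) ⇔ (Sat A e φ → Sat A e ψ)
  ⇒ᶠ-sem e φ ψ φ? = mk⇔ (λ { (inj₁ ¬a) a → ⊥-elim (¬a a) ; (inj₂ b) _ → b }) (by-cases φ?)
    where
    by-cases : Dec (Sat A e φ) → (Sat A e φ → Sat A e ψ) → Sat A e (φ ⇒ᶠ ψ)
    by-cases (yes a) f = inj₂ (f a)
    by-cases (no ¬a) f = inj₁ ¬a

  ⇔ᶠ-sem : ∀ {Δ} (e : Env (n A) Δ) (φ ψ : SO Δ) {a b : Bool} →
           Sat A e φ ⇔ (a ≡ true) → Sat A e ψ ⇔ (b ≡ true) → Sat A e (φ ⇔ᶠ ψ) ⇔ (a ≡ b)
  ⇔ᶠ-sem e φ ψ φ⇔a ψ⇔b =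
    ⇔-trans ((φ⇔a ×-⇔ ψ⇔b) ⊎-⇔ (¬-⇔ φ⇔a ×-⇔ ¬-⇔ ψ⇔b)) (bool-iff _ _)
    where
    bool-iff : ∀ a b → ((a ≡ true × b ≡ true) ⊎ (¬ a ≡ true × ¬ b ≡ true)) ⇔ (a ≡ b)
    bool-iff true  true  = mk⇔ (λ _ → refl) (λ _ → inj₁ (refl , refl))
    bool-iff false false = mk⇔ (λ _ → refl) (λ _ → inj₂ ((λ ()) , (λ ())))
    bool-iff true  false = mk⇔ (λ { (inj₁ (_ , ())) ; (inj₂ (¬t , _)) → ⊥-elim (¬t refl) }) (λ ())
    bool-iff false true  = mk⇔ (λ { (inj₁ (() , _)) ; (inj₂ (_ , ¬t)) → ⊥-elim (¬t refl) }) (λ ())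

  Expresses : ∀ {Δ} {V : Ctx → Set} {X : Set} → Env (n A) Δ → Scope V Δ →
              (∀ {Δ′} → Env (n A) Δ′ → V Δ′ → X) → (X → Set) → Set
  Expresses {Δ} e K val P =
    ∀ {Δ′} (w : Wk Δ Δ′) e′ → Ext w e e′ → ∀ v → Sat A e′ (K w v) ⇔ P (val e′ v)

  ext-there : ∀ {Δ} s {e : Env (n A) Δ} (a : SortVal (n A) s) → Ext {Δ′ = s ∷ Δ} there e (a All.∷ e)
  ext-there s a = extends λ _ → refl

  quantVars-sem : ∀ {Δ} (e : Env (n A) Δ) Q m (K : Scope (FOVars m) Δ) (P : Vec (Fin (n A)) m → Set) →
                  Expresses e K (λ e′ → valVars e′) P → Sat A e (quantVars Q m K) ⇔ ⟦ Q ⟧ (Vec (Fin (n A)) m) P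
  quantVars-sem e Q zero    K P K⇔P = ⇔-trans (K⇔P id e (extends λ _ → refl) []) (⇔-sym (Q-nil Q))
  quantVars-sem e Q (suc m) K P K⇔P =
    ⇔-trans (quant1-sem e Q _)
   (⇔-trans (Q-cong Q λ a → quantVars-sem (a All.∷ e) Q m _ (λ xs → P (a ∷ xs)) (body a))
            (⇔-sym (Q-cons Q)))
    where
    body : ∀ a → Expresses (a All.∷ e) (λ w xs → K (w ∘ there) (w (here refl) ∷ xs))
                           (λ e′ → valVars e′) (λ xs → P (a ∷ xs))
    body a w e′ ext xs =
      ⇔-trans (K⇔P (w ∘ there) e′ (Ext-∘ (ext-there fo a) ext) (w (here refl) ∷ xs))
              (≡⇒⇔ (cong (λ b → P (b ∷ valVars e′ xs)) (at ext (here refl))))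

  mutual
    quantCode-sem : ∀ {Δ} (e : Env (n A) Δ) Q k τ d q (K : Scope (λ Δ′ → CodeVar Δ′ k τ d q) Δ)
                    (P : Code k τ d q → Set) → Expresses e K (λ e′ → valCode e′ k τ d q) P →
                    Sat A e (quantCode Q k τ d q K) ⇔ ⟦ Q ⟧ (Code k τ d q) P
    quantCode-sem e Q zero r d q K P K⇔P =
      ⇔-trans (quant2-sem e Q (q + r) _) (Q-cong Q λ R → K⇔P there (R All.∷ e) (ext-there (so (q + r)) R) (here refl))
    quantCode-sem e Q (suc k) (w , ρs) d q K P K⇔P =
      ⇔-trans (quant2-sem e Q (q + d) _)
     (⇔-trans (Q-cong Q λ S → quantCodes-sem (S All.∷ e) Q k ρs d _ _ (λ cs → P (S , cs)) (body S))
              (⇔-sym (Q-pair Q)))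
      where
      body : ∀ S → Expresses (S All.∷ e) (λ w′ cs → K (w′ ∘ there) (w′ (here refl) , cs))
                             (λ e′ → valCodes e′ k ρs d _) (λ cs → P (S , cs))
      body S w′ e′ ext cs =
        ⇔-trans (K⇔P (w′ ∘ there) e′ (Ext-∘ (ext-there (so (q + d)) S) ext) (w′ (here refl) , cs))
                (≡⇒⇔ (cong (λ S′ → P (S′ , valCodes e′ k ρs d _ cs)) (at ext (here refl))))

    quantCodes-sem : ∀ {Δ} (e : Env (n A) Δ) Q k {m} (ρs : Vec (Ty k) m) d q
                     (K : Scope (λ Δ′ → Shapes (λ a → so a ∈ Δ′) k ρs d q) Δ) (P : Codes k ρs d q → Set) →
                     Expresses e K (λ e′ → valCodes e′ k ρs d q) P →
                     Sat A e (quantCodes Q k ρs d q K) ⇔ ⟦ Q ⟧ (Codes k ρs d q) P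
    quantCodes-sem e Q k []       d q K P K⇔P = ⇔-trans (K⇔P id e (extends λ _ → refl) tt) (⇔-sym (Q-unit Q))
    quantCodes-sem e Q k (ρ ∷ ρs) d q K P K⇔P =
      ⇔-trans (quantCode-sem e Q k ρ d q _ (λ c → ⟦ Q ⟧ (Codes k ρs d q) λ cs → P (c , cs)) body)
              (⇔-sym (Q-pair Q))
      where
      body : Expresses e (λ w c → quantCodes Q k ρs d q λ w′ cs → K (w′ ∘ w) (wkCode w′ k ρ d q c , cs))
                       (λ e′ → valCode e′ k ρ d q) (λ c → ⟦ Q ⟧ (Codes k ρs d q) λ cs → P (c , cs))
      body w e′ ext c =
        quantCodes-sem e′ Q k ρs d q _ (λ cs → P (valCode e′ k ρ d q c , cs)) λ w′ e″ ext′ cs →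
        ⇔-trans (K⇔P (w′ ∘ w) e″ (Ext-∘ ext ext′) (wkCode w′ k ρ d q c , cs))
                (≡⇒⇔ (cong (λ c′ → P (c′ , valCodes e″ k ρs d q cs)) (valCode-wk ext′ k ρ d q c)))

  ∈-cong : ∀ {k w} {ρs : Vec (Ty k) (suc w)} {R R′ : Obj (n A) (suc k) (w , ρs)} {t t′ : Tup (n A) k ρs} →
           R ≡ R′ → (∀ j → t j ≡ t′ j) → (proj₁ R t ≡ true) ⇔ (proj₁ R′ t′ ≡ true)
  ∈-cong {k} {ρs = ρs} {R′ = R′} {t} {t′} refl t≡t′ =
    ≡⇒⇔ (cong (_≡ true) (proj₂ R′ t t′ λ j →
      subst (ObjEq (n A) k (lookup ρs j) (t j)) (t≡t′ j) (≈ᵒ-refl {k})))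

  mutual
    Eqᶠ-sem : ∀ {Δ} (e : Env (n A) Δ) k τ (a b : Coded Δ k τ) →
              Sat A e (Eqᶠ k τ a b) ⇔ ObjEq (n A) k τ (⟦ a ⟧ᶜ e) (⟦ b ⟧ᶜ e)
    Eqᶠ-sem e zero r (coded _ q₁ X₁ p₁) (coded _ q₂ X₂ p₂) =
      quantVars-sem e ∀Q (suc r) (sameAt X₁ p₁ X₂ p₂)
        (λ x → All.lookup e X₁ (cat (valVars e p₁) x) ≡ All.lookup e X₂ (cat (valVars e p₂) x))
        λ w e′ ext x →
          ⇔ᶠ-sem e′ (applyᶠ (w X₁) (Vec.map w p₁) x) (applyᶠ (w X₂) (Vec.map w p₂) x)
                 (applyᶠ-sem ext {q₁} {r} X₁ p₁ x) (applyᶠ-sem ext {q₂} {r} X₂ p₂ x)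
    Eqᶠ-sem e (suc k) (w , ρs) a b =
      ⇔-trans (Inclᶠ-sem e k ρs a b ×-⇔ Inclᶠ-sem e k ρs b a)
              (⇔-sym (≈⇔⊆⊇ k (w , ρs) (⟦ a ⟧ᶜ e) (⟦ b ⟧ᶜ e)))

    Inclᶠ-sem : ∀ {Δ} (e : Env (n A) Δ) k {w} (ρs : Vec (Ty k) (suc w)) (a b : Coded Δ (suc k) (w , ρs)) →
                Sat A e (Inclᶠ k ρs a b) ⇔ Included k (w , ρs) (⟦ a ⟧ᶜ e) (⟦ b ⟧ᶜ e)
    Inclᶠ-sem e k ρs (coded d q (S , cs) p) b =
      ⇔-trans (quantVars-sem e ∀Q (suc d) (entryIn k ρs d S cs p b) _ body)
              (⇔-sym (decode-⊆ k ρs d (All.lookup e S) (valCodes e k ρs d _ cs) (valVars e p) (⟦ b ⟧ᶜ e)))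
      where
      body : Expresses e (entryIn k ρs d S cs p b) (λ e′ → valVars e′) λ y →
               All.lookup e S (cat (valVars e p) y) ≡ true →
               proj₁ (⟦ b ⟧ᶜ e) (entry k ρs d (valCodes e k ρs d _ cs) (valVars e p) y) ≡ true
      body w e′ ext y =
        ⇔-trans (⇒ᶠ-sem e′ (applyᶠ (w S) (Vec.map w p) y) (Indexedᶠ k ρs (wkCoded w b) entries) (_ Bool.≟ true))
                (→-⇔ (applyᶠ-sem ext {q} {d} S p y)
                     (⇔-trans (Indexedᶠ-sem e′ k ρs (wkCoded w b) entries)
                              (∈-cong {ρs = ρs} (⟦⟧ᶜ-wk ext b) (⟦entryᶠ⟧ ext k ρs d cs p y))))
        where entries = entryᶠ k ρs d (mapShapes (λ _ → w) k ρs d _ cs) (Vec.map w p) y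

    Indexedᶠ-sem : ∀ {Δ} (e : Env (n A) Δ) k {w} (ρs : Vec (Ty k) (suc w)) (a : Coded Δ (suc k) (w , ρs))
                   (ts : (j : Fin (suc w)) → Coded Δ k (lookup ρs j)) →
                   Sat A e (Indexedᶠ k ρs a ts) ⇔ (proj₁ (⟦ a ⟧ᶜ e) (λ j → ⟦ ts j ⟧ᶜ e) ≡ true)
    Indexedᶠ-sem e k {w} ρs (coded d q (S , cs) p) ts =
      ⇔-trans (quantVars-sem e ∃Q (suc d) (indexes k ρs d S cs p ts) _ body)
              (⇔-sym (decode-∈ k ρs d (All.lookup e S) (valCodes e k ρs d _ cs) (valVars e p) (λ j → ⟦ ts j ⟧ᶜ e)))
      where
      body : Expresses e (indexes k ρs d S cs p ts) (λ e′ → valVars e′) λ z →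
               (All.lookup e S (cat (valVars e p) z) ≡ true) ×
               TupEq (n A) k ρs (λ j → ⟦ ts j ⟧ᶜ e) (entry k ρs d (valCodes e k ρs d _ cs) (valVars e p) z)
      body w′ e′ ext z =
        applyᶠ-sem ext {q} {d} S p z ×-⇔
        conj-sem e′ w _ _ λ j →
          ⇔-trans (Eqᶠ-sem e′ k (lookup ρs j) _ _)
                  (≡⇒⇔ (cong₂ (ObjEq (n A) k (lookup ρs j))
                              (⟦⟧ᶜ-wk ext (ts j)) (⟦entryᶠ⟧ ext k ρs d cs p z j)))

-- How a variable of the source formula is represented in the target: first and
-- second order variables by themselves, a variable X^{k+3,d,τ} by a code with index
-- length d (the bound d ≥ 1 of every quantified variable is read as pred d + 1).
VarRep : Ctx → Sort → Set
VarRep Δ fo         = fo ∈ Δ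
VarRep Δ (so r)     = so r ∈ Δ
VarRep Δ (ho k τ d) = CodeVar Δ (suc k) τ (pred d) 0

wkRep : ∀ {Δ Δ′} → Wk Δ Δ′ → ∀ s → VarRep Δ s → VarRep Δ′ s
wkRep w fo         x = w x
wkRep w (so r)     X = w X
wkRep w (ho k τ d) c = wkCode w (suc k) τ (pred d) 0 c

Rep : Ctx → Ctx → Set
Rep Γ Δ = ∀ {s} → s ∈ Γ → VarRep Δ s

wkReps : ∀ {Γ Δ Δ′} → Wk Δ Δ′ → Rep Γ Δ → Rep Γ Δ′
wkReps w r {s} x = wkRep w s (r x)

_▸_ : ∀ {Γ Δ s} → VarRep Δ s → Rep Γ Δ → Rep (s ∷ Γ) Δ
(v ▸ r) (here refl) = v
(v ▸ r) (there x)   = r x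

argCoded : ∀ {Γ Δ} → Rep Γ Δ → ∀ k ρ → ArgVar Γ k ρ → Coded Δ k ρ
argCoded r zero    ρ X       = coded 0 0 (r X) []
argCoded r (suc k) ρ (d , X) = coded (pred d) 0 (r X) []

idRep : ∀ m → Rep (FOCtx m) (FOCtx m)
idRep (suc m)     (here refl) = here refl
idRep (suc m) {s} (there x)   = wkRep there s (idRep m x)

module Translation (σ : Vocab) where
  open Formulae σ

  translate : ∀ {i Γ Δ} → Form σ i Γ → Rep Γ Δ → SO Δ
  translate (eq x y)     r = eq (r x) (r y)
  translate (rel R xs)   r = rel R (Vec.map r xs)
  translate (app2 X xs)  r = app2 (r X) (Vec.map r xs)
  translate (appH {k = k} {d = d} {ρs = ρs} X ys) r =
    Indexedᶠ k ρs (coded (pred d) 0 (r X) []) (λ j → argCoded r k (lookup ρs j) (ys j))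
  translate (neg φ)      r = neg (translate φ r)
  translate (and φ ψ)    r = and (translate φ r) (translate ψ r)
  translate (or φ ψ)     r = or (translate φ r) (translate ψ r)
  translate (ex1 φ)      r = quant1 ∃Q (translate φ (here refl ▸ wkReps there r))
  translate (all1 φ)     r = quant1 ∀Q (translate φ (here refl ▸ wkReps there r))
  translate (ex2 s _ φ)  r = quant2 ∃Q s (translate φ (here refl ▸ wkReps there r))
  translate (all2 s _ φ) r = quant2 ∀Q s (translate φ (here refl ▸ wkReps there r))
  translate (exH k τ d _ _ φ)  r = quantCode ∃Q (suc k) τ (pred d) 0 λ w c → translate φ (c ▸ wkReps w r)
  translate (allH k τ d _ _ φ) r = quantCode ∀Q (suc k) τ (pred d) 0 λ w c → translate φ (c ▸ wkReps w r)

module Correctness {σ : Vocab} (A : Structure σ) where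
  open Formulae σ
  open Translation σ
  open Objects (n A)
  open Coding (n A)
  open Semantics A

  Agrees : ∀ {Δ} s → VarRep Δ s → SortVal (n A) s → Env (n A) Δ → Set
  Agrees fo         x a e = All.lookup e x ≡ a
  Agrees (so r)     X R e = All.lookup e X ≡ R
  Agrees (ho k τ d) c R e = ObjEq (n A) (suc k) τ (⟦ coded (pred d) 0 c [] ⟧ᶜ e) R

  record Faithful {Γ Δ} (r : Rep Γ Δ) (eH : Env (n A) Γ) (eS : Env (n A) Δ) : Set where
    constructor faithful
    field
      agrees : ∀ {s} (x : s ∈ Γ) → Agrees s (r x) (All.lookup eH x) eS
  open Faithful

  Agrees-wk : ∀ {Δ Δ′} {w : Wk Δ Δ′} {e e′} → Ext w e e′ →
              ∀ s v a → Agrees s v a e → Agrees s (wkRep w s v) a e′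
  Agrees-wk ext fo         x a x≡a = trans (at ext x) x≡a
  Agrees-wk ext (so r)     X R X≡R = trans (at ext X) X≡R
  Agrees-wk ext (ho k τ d) c R c≈R =
    subst (λ R′ → ObjEq (n A) (suc k) τ R′ R) (sym (⟦⟧ᶜ-wk ext (coded (pred d) 0 c []))) c≈R

  Faithful-wk : ∀ {Γ Δ Δ′} {w : Wk Δ Δ′} {e e′} (r : Rep Γ Δ) {eH} →
                Ext w e e′ → Faithful r eH e → Faithful (wkReps w r) eH e′
  Faithful-wk r ext r≈ = faithful λ {s} x → Agrees-wk ext s (r x) _ (agrees r≈ x)

  Faithful-▸ : ∀ {Γ Δ s} {v : VarRep Δ s} {a : SortVal (n A) s} {r : Rep Γ Δ} {eH eS} →
               Agrees s v a eS → Faithful r eH eS → Faithful (_▸_ {s = s} v r) (All._∷_ {x = s} a eH) eS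
  Faithful-▸ {s = s} {v} {a} {r} {eH} {eS} v≈a r≈ = faithful agrees-▸
    where
    agrees-▸ : ∀ {s′} (x : s′ ∈ s ∷ _) → Agrees s′ ((v ▸ r) x) (All.lookup (All._∷_ {x = s} a eH) x) eS
    agrees-▸ (here refl) = v≈a
    agrees-▸ (there x)   = agrees r≈ x

  valVars-rep : ∀ {Γ Δ} {r : Rep Γ Δ} {eH eS} → Faithful r eH eS → ∀ {m} (xs : Vec (fo ∈ Γ) m) →
                Vec.map (All.lookup eS) (Vec.map r xs) ≡ Vec.map (All.lookup eH) xs
  valVars-rep r≈ []       = refl
  valVars-rep r≈ (x ∷ xs) = cong₂ _∷_ (agrees r≈ x) (valVars-rep r≈ xs)

  argCoded-faithful : ∀ {Γ Δ} {r : Rep Γ Δ} {eH eS} → Faithful r eH eS → ∀ k ρ (y : ArgVar Γ k ρ) →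
                      ObjEq (n A) k ρ (⟦ argCoded r k ρ y ⟧ᶜ eS) (argVal k eH y)
  argCoded-faithful r≈ zero    ρ X       v = cong (λ R → R v) (agrees r≈ X)
  argCoded-faithful r≈ (suc k) ρ (d , X)   = agrees r≈ X

  mutual
    translate-correct : ∀ {i Γ Δ} (φ : Form σ i Γ) (r : Rep Γ Δ) → ∀ eH eS → Faithful r eH eS →
                        Sat A eH φ ⇔ Sat A eS (translate φ r)
    translate-correct (eq x y) r eH eS r≈ = ≡⇒⇔ (sym (cong₂ _≡_ (agrees r≈ x) (agrees r≈ y)))
    translate-correct (rel R xs) r eH eS r≈ =
      ≡⇒⇔ (sym (cong (λ v → All.lookup (rels A) R v ≡ true) (valVars-rep r≈ xs)))
    translate-correct (app2 X xs) r eH eS r≈ =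
      ≡⇒⇔ (sym (cong₂ (λ R v → R v ≡ true) (agrees r≈ X) (valVars-rep r≈ xs)))
    translate-correct (appH {k = k} {d = d} {ρs = ρs} X ys) r eH eS r≈ =
      ⇔-sym (⇔-trans (Indexedᶠ-sem eS k ρs (coded (pred d) 0 (r X) []) args)
                     (≡⇒⇔ (cong (_≡ true) (trans (agrees r≈ X _)
                       (proj₂ (All.lookup eH X) _ _ λ j → argCoded-faithful r≈ k (lookup ρs j) (ys j))))))
      where args = λ j → argCoded r k (lookup ρs j) (ys j)
    translate-correct (neg φ)   r eH eS r≈ = ¬-⇔ (translate-correct φ r eH eS r≈)
    translate-correct (and φ ψ) r eH eS r≈ =
      translate-correct φ r eH eS r≈ ×-⇔ translate-correct ψ r eH eS r≈
    translate-correct (or φ ψ)  r eH eS r≈ =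
      translate-correct φ r eH eS r≈ ⊎-⇔ translate-correct ψ r eH eS r≈
    translate-correct (ex1 φ)      r eH eS r≈ = bind-correct ∃Q fo φ r eH eS r≈ (here refl) λ _ → refl
    translate-correct (all1 φ)     r eH eS r≈ = bind-correct ∀Q fo φ r eH eS r≈ (here refl) λ _ → refl
    translate-correct (ex2 s _ φ)  r eH eS r≈ = bind-correct ∃Q (so s) φ r eH eS r≈ (here refl) λ _ → refl
    translate-correct (all2 s _ φ) r eH eS r≈ = bind-correct ∀Q (so s) φ r eH eS r≈ (here refl) λ _ → refl
    translate-correct (exH k τ (suc d) (s≤s z≤n) _ φ)  r eH eS r≈ = bindH-correct ∃Q k τ d φ r eH eS r≈
    translate-correct (allH k τ (suc d) (s≤s z≤n) _ φ) r eH eS r≈ = bindH-correct ∀Q k τ d φ r eH eS r≈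

    bind-correct : ∀ Q {i Γ Δ} s (φ : Form σ i (s ∷ Γ)) (r : Rep Γ Δ) → ∀ eH eS → Faithful r eH eS →
                   (v : VarRep (s ∷ Δ) s) → (∀ a → Agrees s v a (All._∷_ {x = s} a eS)) →
                   ⟦ Q ⟧ (SortVal (n A) s) (λ a → Sat A (All._∷_ {x = s} a eH) φ) ⇔
                   ⟦ Q ⟧ (SortVal (n A) s) (λ a → Sat A (All._∷_ {x = s} a eS) (translate φ (v ▸ wkReps there r)))
    bind-correct Q s φ r eH eS r≈ v v≈ = Q-cong Q λ a →
      translate-correct φ (v ▸ wkReps there r) (a All.∷ eH) (a All.∷ eS)
                        (Faithful-▸ (v≈ a) (Faithful-wk r (ext-there s a) r≈))

    -- Quantification over a higher order variable: codes with index length d+1 range over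
    -- exactly the objects downward polynomially bounded by d+1.
    bindH-correct : ∀ Q {i Γ Δ} k τ d (φ : Form σ i (ho k τ (suc d) ∷ Γ)) (r : Rep Γ Δ) →
                    ∀ eH eS → Faithful r eH eS →
                    ⟦ Q ⟧ᵇ (Obj (n A) (suc k) τ) (DPB (n A) (suc d) k τ) (λ R → Sat A (R All.∷ eH) φ) ⇔
                    Sat A eS (quantCode Q (suc k) τ d 0 λ w c → translate φ (c ▸ wkReps w r))
    bindH-correct Q k τ d φ r eH eS r≈ =
      ⇔-sym (⇔-trans (quantCode-sem eS Q (suc k) τ d 0 _ P body)
                     (Q-codes Q dec (λ {R} {R′} → DPB-resp (suc d) k τ R R′) (λ c → decode-DPB k τ d c [])
                              (code-complete k τ d)))
      where
      dec : Code (suc k) τ d 0 → Obj (n A) (suc k) τ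
      dec c = decode (suc k) τ d c []
      P : Code (suc k) τ d 0 → Set
      P c = ⟦ Q ⟧ᵇ (Obj (n A) (suc k) τ) (ObjEq (n A) (suc k) τ (dec c)) (λ R → Sat A (R All.∷ eH) φ)
      body : Expresses eS (λ w c → translate φ (c ▸ wkReps w r)) (λ e′ → valCode e′ (suc k) τ d 0) P
      body w e′ ext c =
        ⇔-sym (Qᵇ-const Q (dec c′) (≈ᵒ-refl {suc k} {τ} {dec c′}) λ R c≈R →
          translate-correct φ (c ▸ wkReps w r) (R All.∷ eH) e′ (Faithful-▸ c≈R (Faithful-wk r ext r≈)))
        where c′ = valCode e′ (suc k) τ d 0 c

  idRep-faithful : ∀ m (e : Env (n A) (FOCtx m)) → Faithful (idRep m) e e
  idRep-faithful zero    All.[]      = faithful λ ()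
  idRep-faithful (suc m) (a All.∷ e) = faithful λ where
    (here refl)     → refl
    {s} (there x) → Agrees-wk (ext-there fo a) s (idRep m x) _ (agrees (idRep-faithful m e) x)

theorem4 : (σ : Vocab) (i : ℕ) → 3 ≤ i → (m : ℕ) (φ : Form σ i (FOCtx m)) →
           Σ (Form σ 2 (FOCtx m)) λ ψ →
             (A : Structure σ) (e : Env (n A) (FOCtx m)) → Sat A e φ ⇔ Sat A e ψ
theorem4 σ i _ m φ = translate φ (idRep m) , λ A e →
  let open Correctness A in translate-correct φ (idRep m) e e (idRep-faithful m e)
  where open Translation σ
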